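{- Let $R$ be a principal ideal domain with fraction field $F$, $H$ a free $R$-module of finite rank, and $N\colon H\to H$ a nilpotent homomorphism. Let $\{M_{i,F}\}_i$ be the filtration on $H_F=H\otimes_RF$ associated with $N_F=N\otimes_RF$, and put $M_i=H\cap M_{i,F}$, $\mathrm{Gr}^M_i=M_i/M_{i-1}$. Then the cokernel of $N^i\colon H\to H$ is torsion-free for every $i\ge0$ if and only if $N^i$ induces an isomorphism $\mathrm{Gr}^M_i\cong\mathrm{Gr}^M_{ -i}$ for every $i\ge0$.
   Context: The filtration associated with a nilpotent endomorphism $N_F$ of a finite-dimensional $F$-vector space is the unique increasing, separated, exhaustive filtration $\{M_{i,F}\}$ with $N_F(M_{i,F})\subset M_{i-2,F}$ for all $i$ and $N_F^i\colon M_{i,F}/M_{i-1,F}\xrightarrow{\sim}M_{ -i,F}/M_{ -i-1,F}$ for all $i\ge0$. -}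

module Defs where

open import Level using (Level; _⊔_)
open import Data.Nat using (ℕ; zero; suc)
open import Data.Fin using (Fin; zero; suc)
open import Data.Integer as ℤ using (ℤ; +_)
open import Data.Product using (Σ; ∃; _×_; _,_)
open import Data.Sum using (_⊎_)
open import Relation.Nullary using (¬_)
open import Algebra.Bundles using (CommutativeRing)
open import Algebra.Morphism.Structures using (module RingMorphisms)

module _ {c ℓ : Level} (R : CommutativeRing c ℓ) where
  open CommutativeRing R using (Carrier; _≈_; _+_; _*_; -_; 0#; 1#)

  Vec : ℕ → Set c
  Vec n = Fin n → Carrier

  Mat : ℕ → Set c
  Mat n = Fin n → Fin n → Carrier

  _≈ᵛ_ : ∀ {n} → Vec n → Vec n → Set ℓ
  u ≈ᵛ v = ∀ j → u j ≈ v j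

  0ᵛ : ∀ {n} → Vec n
  0ᵛ _ = 0#

  _+ᵛ_ : ∀ {n} → Vec n → Vec n → Vec n
  (u +ᵛ v) j = u j + v j

  _-ᵛ_ : ∀ {n} → Vec n → Vec n → Vec n
  (u -ᵛ v) j = u j + (- v j)

  _·ᵛ_ : ∀ {n} → Carrier → Vec n → Vec n
  (r ·ᵛ v) j = r * v j

  sumF : ∀ n → (Fin n → Carrier) → Carrier
  sumF zero    f = 0#
  sumF (suc n) f = f zero + sumF n (λ j → f (suc j))

  apply : ∀ {n} → Mat n → Vec n → Vec n
  apply {n} A v i = sumF n (λ j → A i j * v j)

  pow : ∀ {n} → Mat n → ℕ → Vec n → Vec n
  pow A zero    v = v
  pow A (suc k) v = apply A (pow A k v)

  Nilpotent : ∀ {n} → Mat n → Set (c ⊔ ℓ)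
  Nilpotent {n} A = ∃ λ k → ∀ (v : Vec n) → pow A k v ≈ᵛ 0ᵛ

  IsIntegralDomain : Set (c ⊔ ℓ)
  IsIntegralDomain = (¬ (1# ≈ 0#)) × (∀ x y → x * y ≈ 0# → (x ≈ 0#) ⊎ (y ≈ 0#))

  record Ideal : Set (Level.suc (c ⊔ ℓ)) where
    field
      mem   : Carrier → Set (c ⊔ ℓ)
      resp  : ∀ {x y} → x ≈ y → mem x → mem y
      0∈    : mem 0#
      +∈    : ∀ {x y} → mem x → mem y → mem (x + y)
      *∈    : ∀ r {x} → mem x → mem (r * x)

  IsPrincipal : Ideal → Set (c ⊔ ℓ)
  IsPrincipal I = ∃ λ a → ∀ x → (Ideal.mem I x → ∃ λ r → x ≈ r * a)
                                × ((∃ λ r → x ≈ r * a) → Ideal.mem I x)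

  IsPID : Set (Level.suc (c ⊔ ℓ))
  IsPID = IsIntegralDomain × (∀ (I : Ideal) → IsPrincipal I)

  IsField : Set (c ⊔ ℓ)
  IsField = (¬ (1# ≈ 0#)) × (∀ x → ¬ (x ≈ 0#) → ∃ λ y → x * y ≈ 1#)

  VPred : ℕ → Set (Level.suc (c ⊔ ℓ))
  VPred n = Vec n → Set (c ⊔ ℓ)

  record Subspace (n : ℕ) : Set (Level.suc (c ⊔ ℓ)) where
    field
      mem  : VPred n
      resp : ∀ {u v} → u ≈ᵛ v → mem u → mem v
      0∈   : mem 0ᵛ
      +∈   : ∀ {u v} → mem u → mem v → mem (u +ᵛ v)
      ·∈   : ∀ r {v} → mem v → mem (r ·ᵛ v)

  -- f : R^n → R^n induces an isomorphism P/P' ≅ Q/Q' (P' ⊆ P, Q' ⊆ Q):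
  -- well defined (f P ⊆ Q, f P' ⊆ Q'), injective and surjective on quotients.
  InducesIso : ∀ {n} → (Vec n → Vec n) → (P P' Q Q' : VPred n) → Set (c ⊔ ℓ)
  InducesIso f P P' Q Q' =
      (∀ x → P x → Q (f x))
    × (∀ x → P' x → Q' (f x))
    × (∀ x → P x → Q' (f x) → P' x)
    × (∀ y → Q y → ∃ λ x → P x × Q' (f x -ᵛ y))

  TorsionFreeCoker : ∀ {n} → (Vec n → Vec n) → Set (c ⊔ ℓ)
  TorsionFreeCoker {n} f =
    ∀ (r : Carrier) (y : Vec n) → ¬ (r ≈ 0#) →
      (∃ λ x → f x ≈ᵛ (r ·ᵛ y)) → ∃ λ x → f x ≈ᵛ y

  record IsAssociatedFiltration {n} (A : Mat n) (M : ℤ → Subspace n) : Set (c ⊔ ℓ) where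
    field
      increasing : ∀ i v → Subspace.mem (M i) v → Subspace.mem (M (i ℤ.+ + 1)) v
      separated  : ∃ λ a → ∀ i → i ℤ.≤ a → ∀ v → Subspace.mem (M i) v → v ≈ᵛ 0ᵛ
      exhaustive : ∃ λ b → ∀ i → b ℤ.≤ i → ∀ v → Subspace.mem (M i) v
      lowers     : ∀ i v → Subspace.mem (M i) v → Subspace.mem (M (i ℤ.- + 2)) (apply A v)
      iso        : ∀ (i : ℕ) → InducesIso (pow A i)
                     (Subspace.mem (M (+ i)))     (Subspace.mem (M (+ i ℤ.- + 1)))
                     (Subspace.mem (M (ℤ.- + i))) (Subspace.mem (M (ℤ.- + i ℤ.- + 1)))

module _ {c ℓ : Level} (R F : CommutativeRing c ℓ) where
  private
    module R = CommutativeRing R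
    module F = CommutativeRing F

  IsFractionField : (R.Carrier → F.Carrier) → Set (c ⊔ ℓ)
  IsFractionField ι =
      RingMorphisms.IsRingHomomorphism R.rawRing F.rawRing ι
    × (∀ x y → ι x F.≈ ι y → x R.≈ y)
    × (∀ (f : F.Carrier) → ∃ λ a → ∃ λ b → ¬ (b R.≈ R.0#) × (f F.* ι b F.≈ ι a))

  mapMat : ∀ {n} → (R.Carrier → F.Carrier) → Mat R n → Mat F n
  mapMat ι A i j = ι (A i j)

  restrict : ∀ {n} → (R.Carrier → F.Carrier) → VPred F n → VPred R n
  restrict ι P x = P (λ j → ι (x j))

-- Put H = R^n ⊂ F^n and Mᴴ i = H ∩ M i.  Over F, N^i : Gr_i → Gr_{-i} is an
-- isomorphism, so on H it is automatically well defined and injective: only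
-- surjectivity is at stake.  Two facts drive both directions: graded
-- surjectivity, iterated down to where the separated filtration vanishes,
-- puts all of M (-j) into the image of N^j; and N^k u ∈ M (s - k) forces
-- u ∈ M (s + k), by descending from an index where u certainly lies, using
-- injectivity on each graded piece.
-- If coker N^i is torsion free, clearing the denominators of a preimage over
-- F of y ∈ Mᴴ (-i) puts a nonzero multiple of y, hence y itself, into N^i(H),
-- and every such preimage lies in Mᴴ i.  Conversely, if
-- b y = N^k x with b ≠ 0, then y ∈ N^k(F^n) ∩ M (s - k) for some s, and
-- y ∈ N^k(H) follows by induction on s: for s = 0 by graded surjectivity on
-- H; for s > 0 graded surjectivity in degree s + k applied to N^s y yields
-- x′ ∈ H with N^k x′ - y ∈ N^k(F^n) ∩ M (s - 1 - k).
module Submission where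

open import Defs
open import Level using (Level; _⊔_)
open import Data.Nat as ℕ using (ℕ; zero; suc)
import Data.Nat.Properties as ℕ
open import Data.Fin using (Fin; zero; suc)
open import Data.Integer as ℤ using (ℤ; +_)
import Data.Integer.Properties as ℤ
open import Data.Integer.Tactic.RingSolver using (solve-∀)
open import Data.Product using (∃; _×_; _,_; proj₁; proj₂)
open import Data.Sum using (inj₁; inj₂)
open import Relation.Nullary using (¬_)
open import Relation.Binary.PropositionalEquality as ≡ using (_≡_)
open import Algebra.Bundles using (CommutativeRing)
open import Algebra.Morphism.Structures using (module RingMorphisms)
open import Function.Bundles using (_⇔_; mk⇔)

i≤+∣i∣ : ∀ i → i ℤ.≤ + ℤ.∣ i ∣
i≤+∣i∣ (+ m)      = ℤ.≤-refl
i≤+∣i∣ ℤ.-[1+ m ] = ℤ.-≤+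

-+∣i∣≤i : ∀ i → ℤ.- + ℤ.∣ i ∣ ℤ.≤ i
-+∣i∣≤i (+ m)      = ℤ.neg-≤-pos
-+∣i∣≤i ℤ.-[1+ m ] = ℤ.≤-refl

module VectorAlgebra {c ℓ : Level} (S : CommutativeRing c ℓ) where
  open CommutativeRing S hiding (zero)
  open import Algebra.Properties.CommutativeSemigroup +-commutativeSemigroup
    using (interchange)
  open import Algebra.Properties.CommutativeSemigroup *-commutativeSemigroup
    using (x∙yz≈y∙xz)
  open import Algebra.Properties.AbelianGroup +-abelianGroup
    using (⁻¹-anti-homo‿-; xyx⁻¹≈y)
  open import Algebra.Properties.Ring ring using (-1*x≈-x)
  open import Relation.Binary.Reasoning.Setoid setoid

  infix 4 _≋_
  _≋_ : ∀ {n} → Vec S n → Vec S n → Set ℓ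
  _≋_ = _≈ᵛ_ S

  x-[x-y]≈y : ∀ x y → x - (x - y) ≈ y
  x-[x-y]≈y x y = begin
    x + - (x - y) ≈⟨ +-congˡ (⁻¹-anti-homo‿- x y) ⟩
    x + (y - x)   ≈⟨ +-assoc x y (- x) ⟨
    x + y - x     ≈⟨ xyx⁻¹≈y x y ⟩
    y             ∎

  ≋⇒-ᵛ≋0ᵛ : ∀ {n} {u v : Vec S n} → u ≋ v → _-ᵛ_ S u v ≋ 0ᵛ S
  ≋⇒-ᵛ≋0ᵛ u≋v j = trans (+-congʳ (u≋v j)) (-‿inverseʳ _)

  -ᵛ-∈ : ∀ {n} (W : Subspace S n) {u v} →
         Subspace.mem W u → Subspace.mem W v → Subspace.mem W (_-ᵛ_ S u v)
  -ᵛ-∈ W u∈ v∈ = Subspace.resp W (λ j → +-congˡ (-1*x≈-x _))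
                   (Subspace.+∈ W u∈ (Subspace.·∈ W (- 1#) v∈))

  sumF-cong : ∀ n {f g : Fin n → Carrier} → (∀ j → f j ≈ g j) → sumF S n f ≈ sumF S n g
  sumF-cong zero    f≈g = refl
  sumF-cong (suc n) f≈g = +-cong (f≈g zero) (sumF-cong n (λ j → f≈g (suc j)))

  sumF-+ : ∀ n (f g : Fin n → Carrier) →
           sumF S n (λ j → f j + g j) ≈ sumF S n f + sumF S n g
  sumF-+ zero    f g = sym (+-identityˡ 0#)
  sumF-+ (suc n) f g = trans (+-congˡ (sumF-+ n _ _)) (interchange _ _ _ _)

  sumF-* : ∀ n r (f : Fin n → Carrier) → sumF S n (λ j → r * f j) ≈ r * sumF S n f
  sumF-* zero    r f = sym (zeroʳ r)
  sumF-* (suc n) r f = trans (+-congˡ (sumF-* n r _)) (sym (distribˡ r _ _))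

  module _ {n : ℕ} (A : Mat S n) where
    apply-cong : ∀ {u v} → u ≋ v → apply S A u ≋ apply S A v
    apply-cong u≋v i = sumF-cong n (λ j → *-congˡ (u≋v j))

    apply-+ᵛ : ∀ u v → apply S A (_+ᵛ_ S u v) ≋ _+ᵛ_ S (apply S A u) (apply S A v)
    apply-+ᵛ u v i =
      trans (sumF-cong n (λ j → distribˡ (A i j) (u j) (v j))) (sumF-+ n _ _)

    apply-·ᵛ : ∀ r v → apply S A (_·ᵛ_ S r v) ≋ _·ᵛ_ S r (apply S A v)
    apply-·ᵛ r v i =
      trans (sumF-cong n (λ j → x∙yz≈y∙xz (A i j) r (v j))) (sumF-* n r _)

    pow-cong : ∀ k {u v} → u ≋ v → pow S A k u ≋ pow S A k v
    pow-cong zero    u≋v = u≋v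
    pow-cong (suc k) u≋v = apply-cong (pow-cong k u≋v)

    pow-+ᵛ : ∀ k u v → pow S A k (_+ᵛ_ S u v) ≋ _+ᵛ_ S (pow S A k u) (pow S A k v)
    pow-+ᵛ zero    u v i = refl
    pow-+ᵛ (suc k) u v i = trans (apply-cong (pow-+ᵛ k u v) i) (apply-+ᵛ _ _ i)

    pow-·ᵛ : ∀ k r v → pow S A k (_·ᵛ_ S r v) ≋ _·ᵛ_ S r (pow S A k v)
    pow-·ᵛ zero    r v i = refl
    pow-·ᵛ (suc k) r v i = trans (apply-cong (pow-·ᵛ k r v) i) (apply-·ᵛ _ _ i)

    pow-0ᵛ : ∀ k → pow S A k (0ᵛ S) ≋ 0ᵛ S
    pow-0ᵛ k i =
      trans (pow-cong k (λ _ → sym (zeroˡ 0#)) i) (trans (pow-·ᵛ k 0# _ i) (zeroˡ _))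

    pow--ᵛ : ∀ k u v → pow S A k (_-ᵛ_ S u v) ≋ _-ᵛ_ S (pow S A k u) (pow S A k v)
    pow--ᵛ k u v i = begin
      pow S A k (_-ᵛ_ S u v) i                      ≈⟨ pow-cong k (λ j → +-congˡ (sym (-1*x≈-x (v j)))) i ⟩
      pow S A k (_+ᵛ_ S u (_·ᵛ_ S (- 1#) v)) i      ≈⟨ pow-+ᵛ k _ _ i ⟩
      pow S A k u i + pow S A k (_·ᵛ_ S (- 1#) v) i ≈⟨ +-congˡ (pow-·ᵛ k _ _ i) ⟩
      pow S A k u i + - 1# * pow S A k v i          ≈⟨ +-congˡ (-1*x≈-x _) ⟩
      pow S A k u i - pow S A k v i                 ∎

    pow-+ : ∀ a b v → pow S A (a ℕ.+ b) v ≡ pow S A a (pow S A b v)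
    pow-+ zero    b v = ≡.refl
    pow-+ (suc a) b v = ≡.cong (apply S A) (pow-+ a b v)

module ExtensionOfScalars {c ℓ : Level} (R F : CommutativeRing c ℓ)
  {ι : CommutativeRing.Carrier R → CommutativeRing.Carrier F}
  (hom : RingMorphisms.IsRingHomomorphism
           (CommutativeRing.rawRing R) (CommutativeRing.rawRing F) ι) where
  private
    module F = CommutativeRing F
    module VF = VectorAlgebra F
  open RingMorphisms.IsRingHomomorphism hom

  ιᵛ : ∀ {n} → Vec R n → Vec F n
  ιᵛ v j = ι (v j)

  ιᵛ--ᵛ : ∀ {n} (u v : Vec R n) → ιᵛ (_-ᵛ_ R u v) VF.≋ _-ᵛ_ F (ιᵛ u) (ιᵛ v)
  ιᵛ--ᵛ u v j = F.trans (+-homo _ _) (F.+-congˡ (-‿homo (v j)))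

  ι-sumF : ∀ n f → ι (sumF R n f) F.≈ sumF F n (λ j → ι (f j))
  ι-sumF zero    f = 0#-homo
  ι-sumF (suc n) f = F.trans (+-homo _ _) (F.+-congˡ (ι-sumF n _))

  module _ {n : ℕ} (A : Mat R n) where
    ιᵛ-apply : ∀ v → ιᵛ (apply R A v) VF.≋ apply F (mapMat R F ι A) (ιᵛ v)
    ιᵛ-apply v i = F.trans (ι-sumF n _) (VF.sumF-cong n (λ j → *-homo _ _))

    ιᵛ-pow : ∀ k v → ιᵛ (pow R A k v) VF.≋ pow F (mapMat R F ι A) k (ιᵛ v)
    ιᵛ-pow zero    v i = F.refl
    ιᵛ-pow (suc k) v i =
      F.trans (ιᵛ-apply _ i) (VF.apply-cong (mapMat R F ι A) (ιᵛ-pow k v) i)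

module _ {c ℓ : Level} (R F : CommutativeRing c ℓ)
  {ι : CommutativeRing.Carrier R → CommutativeRing.Carrier F}
  (domain : IsIntegralDomain R) (frac : IsFractionField R F ι) where
  private
    module R = CommutativeRing R
    module F = CommutativeRing F
  open RingMorphisms.IsRingHomomorphism (proj₁ frac) using (*-homo)
  open import Algebra.Properties.CommutativeSemigroup F.*-commutativeSemigroup
    using (x∙yz≈y∙xz)
  open import Relation.Binary.Reasoning.Setoid F.setoid

  clear-denominators : ∀ m (u : Vec F m) → ∃ λ b → ∃ λ (x : Vec R m) →
                       ¬ (b R.≈ R.0#) × (∀ j → u j F.* ι b F.≈ ι (x j))
  clear-denominators zero    u = R.1# , (λ ()) , proj₁ domain , (λ ())
  clear-denominators (suc m) u
    with proj₂ (proj₂ frac) (u zero) | clear-denominators m (λ j → u (suc j))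
  ... | a₀ , b₀ , b₀≉0 , u₀b₀≈a₀ | b , x , b≉0 , ub≈x = b₀ R.* b , x′ , b₀b≉0 , ub₀b≈x′
    where
    x′ : Vec R (suc m)
    x′ zero    = a₀ R.* b
    x′ (suc j) = b₀ R.* x j
    b₀b≉0 : ¬ (b₀ R.* b R.≈ R.0#)
    b₀b≉0 b₀b≈0 with proj₂ domain b₀ b b₀b≈0
    ... | inj₁ b₀≈0 = b₀≉0 b₀≈0
    ... | inj₂ b≈0  = b≉0 b≈0
    ub₀b≈x′ : ∀ j → u j F.* ι (b₀ R.* b) F.≈ ι (x′ j)
    ub₀b≈x′ zero = begin
      u zero F.* ι (b₀ R.* b)  ≈⟨ F.*-congˡ (*-homo b₀ b) ⟩
      u zero F.* (ι b₀ F.* ι b) ≈⟨ F.*-assoc _ _ _ ⟨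
      u zero F.* ι b₀ F.* ι b   ≈⟨ F.*-congʳ u₀b₀≈a₀ ⟩
      ι a₀ F.* ι b              ≈⟨ *-homo a₀ b ⟨
      ι (a₀ R.* b)              ∎
    ub₀b≈x′ (suc j) = begin
      u (suc j) F.* ι (b₀ R.* b)  ≈⟨ F.*-congˡ (*-homo b₀ b) ⟩
      u (suc j) F.* (ι b₀ F.* ι b) ≈⟨ x∙yz≈y∙xz _ _ _ ⟩
      ι b₀ F.* (u (suc j) F.* ι b) ≈⟨ F.*-congˡ (ub≈x j) ⟩
      ι b₀ F.* ι (x j)             ≈⟨ *-homo b₀ (x j) ⟨
      ι (b₀ R.* x j)               ∎

module _ {c ℓ : Level} (S : CommutativeRing c ℓ) {n : ℕ} (A : Mat S n)
  (P : ℤ → VPred S n)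
  (separated : ∃ λ a → ∀ i → i ℤ.≤ a → ∀ v → P i v → _≈ᵛ_ S v (0ᵛ S))
  (graded-surjective : ∀ j y → P (ℤ.- + j) y →
                       ∃ λ x → P (ℤ.- + j ℤ.- + 1) (_-ᵛ_ S (pow S A j x) y)) where
  open CommutativeRing S hiding (zero)
  open VectorAlgebra S
  open import Relation.Binary.Reasoning.Setoid setoid

  pow-onto-negative-part : ∀ j y → P (ℤ.- + j) y → ∃ λ u → pow S A j u ≋ y
  pow-onto-negative-part j y = go ℤ.∣ a ∣ j (ℕ.m≤m+n _ j) y
    where
    a = proj₁ separated
    -j-1≡-[1+j] : ∀ j → ℤ.- j ℤ.- + 1 ≡ ℤ.- (+ 1 ℤ.+ j)
    -j-1≡-[1+j] = solve-∀
    go : ∀ d j → ℤ.∣ a ∣ ℕ.≤ d ℕ.+ j → ∀ y → P (ℤ.- + j) y → ∃ λ u → pow S A j u ≋ y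
    go zero    j ∣a∣≤j y y∈ = 0ᵛ S , λ i → trans (pow-0ᵛ A j i) (sym (y≋0 i))
      where
      y≋0 : y ≋ 0ᵛ S
      y≋0 = proj₂ separated _ (ℤ.≤-trans (ℤ.neg-mono-≤ (ℤ.+≤+ ∣a∣≤j)) (-+∣i∣≤i a)) y y∈
    go (suc d) j ∣a∣≤ y y∈ = correct (graded-surjective j y y∈)
      where
      correct : (∃ λ x → P (ℤ.- + j ℤ.- + 1) (_-ᵛ_ S (pow S A j x) y)) →
                ∃ λ u → pow S A j u ≋ y
      correct (x , r∈) = _-ᵛ_ S x (apply S A u) , λ i → begin
        pow S A j (_-ᵛ_ S x (apply S A u)) i      ≈⟨ pow--ᵛ A j _ _ i ⟩
        pow S A j x i - pow S A j (apply S A u) i ≡⟨ ≡.cong (λ w → pow S A j x i - w i) Nʲ∘N≡Nʲ⁺¹ ⟩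
        pow S A j x i - pow S A (suc j) u i       ≈⟨ +-congˡ (-‿cong (Nʲ⁺¹u≋r i)) ⟩
        pow S A j x i - (pow S A j x i - y i)     ≈⟨ x-[x-y]≈y _ _ ⟩
        y i                                       ∎
        where
        r = _-ᵛ_ S (pow S A j x) y
        preimage-of-r : ∃ λ u → pow S A (suc j) u ≋ r
        preimage-of-r = go d (suc j) (≡.subst (ℤ.∣ a ∣ ℕ.≤_) (≡.sym (ℕ.+-suc d j)) ∣a∣≤)
                          r (≡.subst (λ i → P i r) (-j-1≡-[1+j] (+ j)) r∈)
        u = proj₁ preimage-of-r
        Nʲ⁺¹u≋r = proj₂ preimage-of-r
        Nʲ∘N≡Nʲ⁺¹ : pow S A j (apply S A u) ≡ pow S A (suc j) u
        Nʲ∘N≡Nʲ⁺¹ =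
          ≡.trans (≡.sym (pow-+ A j 1 u)) (≡.cong (λ m → pow S A m u) (ℕ.+-comm j 1))

module AssociatedFiltration {c ℓ : Level} (F : CommutativeRing c ℓ) {n : ℕ}
  {A : Mat F n} {M : ℤ → Subspace F n} (filt : IsAssociatedFiltration F A M) where
  open IsAssociatedFiltration filt
  open VectorAlgebra F using (pow-+)

  M[_] : ℤ → VPred F n
  M[ i ] = Subspace.mem (M i)

  reindex : ∀ {i j v} → i ≡ j → M[ i ] v → M[ j ] v
  reindex {v = v} i≡j = ≡.subst (λ i → M[ i ] v) i≡j

  M-mono : ∀ d {i v} → M[ i ] v → M[ i ℤ.+ + d ] v
  M-mono zero    {i} v∈ = reindex (≡.sym (ℤ.+-identityʳ i)) v∈
  M-mono (suc d) {i} v∈ = reindex (ℤ.+-assoc i (+ 1) (+ d)) (M-mono d (increasing i _ v∈))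

  M-pow : ∀ t {i v} → M[ i ] v → M[ i ℤ.- + (t ℕ.+ t) ] (pow F A t v)
  M-pow zero    {i} v∈ = reindex (≡.sym (ℤ.+-identityʳ i)) v∈
  M-pow (suc t) {i} v∈ = reindex (shift i (+ t)) (lowers _ _ (M-pow t v∈))
    where
    shift : ∀ i t → i ℤ.- (t ℤ.+ t) ℤ.- + 2 ≡ i ℤ.- ((+ 1 ℤ.+ t) ℤ.+ (+ 1 ℤ.+ t))
    shift = solve-∀

  pow-reflects-step : ∀ k t {u} → M[ + (t ℕ.+ k) ] u →
                      M[ + t ℤ.- + k ℤ.- + 1 ] (pow F A k u) → M[ + (t ℕ.+ k) ℤ.- + 1 ] u
  pow-reflects-step k t {u} u∈ Nᵏu∈ = proj₁ (proj₂ (proj₂ (iso (t ℕ.+ k)))) u u∈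
    (≡.subst M[ _ ] (≡.sym (pow-+ A t k u)) (reindex (shift (+ t) (+ k)) (M-pow t Nᵏu∈)))
    where
    shift : ∀ t k → t ℤ.- k ℤ.- + 1 ℤ.- (t ℤ.+ t) ≡ ℤ.- (t ℤ.+ k) ℤ.- + 1
    shift = solve-∀

  pow-reflects : ∀ k s {u} → M[ + s ℤ.- + k ] (pow F A k u) → M[ + (s ℕ.+ k) ] u
  pow-reflects k s {u} Nᵏu∈ = descend B (proj₂ exhaustive _ b≤ u)
    where
    b = proj₁ exhaustive
    B = ℤ.∣ b ∣
    b≤ : b ℤ.≤ + (B ℕ.+ s ℕ.+ k)
    b≤ = ℤ.≤-trans (i≤+∣i∣ b) (ℤ.+≤+ (ℕ.≤-trans (ℕ.m≤m+n B s) (ℕ.m≤m+n _ k)))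
    lower : ∀ s k e → s ℤ.- k ℤ.+ e ≡ (+ 1 ℤ.+ e) ℤ.+ s ℤ.- k ℤ.- + 1
    lower = solve-∀
    upper : ∀ e s k → (+ 1 ℤ.+ e) ℤ.+ s ℤ.+ k ℤ.- + 1 ≡ e ℤ.+ s ℤ.+ k
    upper = solve-∀
    descend : ∀ e → M[ + (e ℕ.+ s ℕ.+ k) ] u → M[ + (s ℕ.+ k) ] u
    descend zero    u∈ = u∈
    descend (suc e) u∈ = descend e (reindex (upper (+ e) (+ s) (+ k))
      (pow-reflects-step k (suc e ℕ.+ s) u∈
        (reindex (lower (+ s) (+ k) (+ e)) (M-mono e Nᵏu∈))))

module Lattice {c ℓ : Level} (R F : CommutativeRing c ℓ)
  {ι : CommutativeRing.Carrier R → CommutativeRing.Carrier F}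
  (domain : IsIntegralDomain R) (frac : IsFractionField R F ι)
  {n : ℕ} (N : Mat R n) {MF : ℤ → Subspace F n}
  (filt : IsAssociatedFiltration F (mapMat R F ι N) MF) where
  private
    module R = CommutativeRing R
    module F = CommutativeRing F
    module VR = VectorAlgebra R
    module VF = VectorAlgebra F
  open IsAssociatedFiltration filt using (iso; separated; exhaustive)
  open AssociatedFiltration F filt
  open ExtensionOfScalars R F (proj₁ frac)
  open RingMorphisms.IsRingHomomorphism (proj₁ frac) using (⟦⟧-cong; 0#-homo; *-homo)
  open import Relation.Binary.Reasoning.Setoid F.setoid

  Nᶠ : Mat F n
  Nᶠ = mapMat R F ι N

  Mᴴ[_] : ℤ → VPred R n
  Mᴴ[ i ] = restrict R F ι M[ i ]

  GradedIso : ℕ → Set (c ⊔ ℓ)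
  GradedIso i = InducesIso R (pow R N i)
    Mᴴ[ + i ] Mᴴ[ + i ℤ.- + 1 ] Mᴴ[ ℤ.- + i ] Mᴴ[ ℤ.- + i ℤ.- + 1 ]

  M-resp : ∀ i {u v} → u VF.≋ v → M[ i ] u → M[ i ] v
  M-resp i = Subspace.resp (MF i)

  ι-injective : ∀ x y → ι x F.≈ ι y → x R.≈ y
  ι-injective = proj₁ (proj₂ frac)

  ι≉0 : ∀ {r} → ¬ (r R.≈ R.0#) → ¬ (ι r F.≈ F.0#)
  ι≉0 r≉0 ιr≈0 = r≉0 (ι-injective _ _ (F.trans ιr≈0 (F.sym 0#-homo)))

  ιᵛ-injective : ∀ {u v : Vec R n} → ιᵛ u VF.≋ ιᵛ v → u VR.≋ v
  ιᵛ-injective ιu≋ιv j = ι-injective _ _ (ιu≋ιv j)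

  Mᴴ-0 : ∀ i {x} → x VR.≋ 0ᵛ R → Mᴴ[ i ] x
  Mᴴ-0 i x≋0 = M-resp i (λ j → F.sym (F.trans (⟦⟧-cong (x≋0 j)) 0#-homo)) (Subspace.0∈ (MF i))

  ιᵛ-pow-∈ : ∀ i k {x} → M[ i ] (pow F Nᶠ k (ιᵛ x)) → Mᴴ[ i ] (pow R N k x)
  ιᵛ-pow-∈ i k {x} = M-resp i (λ j → F.sym (ιᵛ-pow N k x j))

  ιᵛ-pow-∈⁻ : ∀ i k {x} → Mᴴ[ i ] (pow R N k x) → M[ i ] (pow F Nᶠ k (ιᵛ x))
  ιᵛ-pow-∈⁻ i k {x} = M-resp i (ιᵛ-pow N k x)

  ιᵛ-pow--ᵛ : ∀ k x {u z} → pow F Nᶠ k u VF.≋ ιᵛ z →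
              pow F Nᶠ k (_-ᵛ_ F (ιᵛ x) u) VF.≋ ιᵛ (_-ᵛ_ R (pow R N k x) z)
  ιᵛ-pow--ᵛ k x {u} {z} Nᵏu≋z j = begin
    pow F Nᶠ k (_-ᵛ_ F (ιᵛ x) u) j          ≈⟨ VF.pow--ᵛ Nᶠ k (ιᵛ x) u j ⟩
    pow F Nᶠ k (ιᵛ x) j F.- pow F Nᶠ k u j  ≈⟨ F.+-cong (F.sym (ιᵛ-pow N k x j)) (F.-‿cong (Nᵏu≋z j)) ⟩
    ι (pow R N k x j) F.- ι (z j)           ≈⟨ ιᵛ--ᵛ (pow R N k x) z j ⟨
    ι (pow R N k x j R.- z j)               ∎

  Mᴴ-pow-reflects : ∀ k {x y} → pow R N k x VR.≋ y → Mᴴ[ ℤ.- + k ] y → Mᴴ[ + k ] x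
  Mᴴ-pow-reflects k {x} Nᵏx≋y y∈ = pow-reflects k 0 (reindex (≡.sym (ℤ.+-identityˡ _))
    (M-resp _ (λ j → F.trans (F.sym (⟦⟧-cong (Nᵏx≋y j))) (ιᵛ-pow N k x j)) y∈))

  negative-part-in-image : ∀ j y → M[ ℤ.- + j ] y → ∃ λ u → pow F Nᶠ j u VF.≋ y
  negative-part-in-image = pow-onto-negative-part F Nᶠ M[_] separated
    (λ j y y∈ → let (x , _ , r∈) = proj₂ (proj₂ (proj₂ (iso j))) y y∈ in x , r∈)

  multiple-in-image : ∀ k y u → pow F Nᶠ k u VF.≋ ιᵛ y →
                      ∃ λ b → ¬ (b R.≈ R.0#) × ∃ λ x → pow R N k x VR.≋ _·ᵛ_ R b y
  multiple-in-image k y u Nᵏu≋y =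
    let (b , x , b≉0 , ub≈x) = clear-denominators R F domain frac n u in
    b , b≉0 , x , ιᵛ-injective λ j → begin
      ι (pow R N k x j)                 ≈⟨ ιᵛ-pow N k x j ⟩
      pow F Nᶠ k (ιᵛ x) j               ≈⟨ VF.pow-cong Nᶠ k (λ j → F.trans (F.sym (ub≈x j)) (F.*-comm _ _)) j ⟩
      pow F Nᶠ k (_·ᵛ_ F (ι b) u) j     ≈⟨ VF.pow-·ᵛ Nᶠ k (ι b) u j ⟩
      ι b F.* pow F Nᶠ k u j            ≈⟨ F.*-congˡ (Nᵏu≋y j) ⟩
      ι b F.* ι (y j)                   ≈⟨ *-homo b (y j) ⟨
      ι (b R.* y j)                     ∎

  torsion-free⇒graded-iso : (∀ i → TorsionFreeCoker R (pow R N i)) → ∀ i → GradedIso i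
  torsion-free⇒graded-iso tf i =
      (λ x x∈ → ιᵛ-pow-∈ _ i (proj₁ (iso i) (ιᵛ x) x∈))
    , (λ x x∈ → ιᵛ-pow-∈ _ i (proj₁ (proj₂ (iso i)) (ιᵛ x) x∈))
    , (λ x x∈ Nⁱx∈ → proj₁ (proj₂ (proj₂ (iso i))) (ιᵛ x) x∈ (ιᵛ-pow-∈⁻ _ i Nⁱx∈))
    , onto
    where
    onto : ∀ y → Mᴴ[ ℤ.- + i ] y →
           ∃ λ x → Mᴴ[ + i ] x × Mᴴ[ ℤ.- + i ℤ.- + 1 ] (_-ᵛ_ R (pow R N i x) y)
    onto y y∈ =
      let (u , Nⁱu≋y)        = negative-part-in-image i (ιᵛ y) y∈
          (b , b≉0 , Nⁱx≋by) = multiple-in-image i y u Nⁱu≋y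
          (x , Nⁱx≋y)        = tf i b y b≉0 Nⁱx≋by
      in x , Mᴴ-pow-reflects i Nⁱx≋y y∈ , Mᴴ-0 _ (VR.≋⇒-ᵛ≋0ᵛ Nⁱx≋y)

  module _ (graded-iso : ∀ i → GradedIso i) where
    lattice-negative-part-in-image : ∀ j y → Mᴴ[ ℤ.- + j ] y → ∃ λ x → pow R N j x VR.≋ y
    lattice-negative-part-in-image = pow-onto-negative-part R N Mᴴ[_] separatedᴴ
      (λ j y y∈ → let (x , _ , r∈) = proj₂ (proj₂ (proj₂ (graded-iso j))) y y∈ in x , r∈)
      where
      separatedᴴ : ∃ λ a → ∀ i → i ℤ.≤ a → ∀ x → Mᴴ[ i ] x → x VR.≋ 0ᵛ R
      separatedᴴ = let (a , sep) = separated in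
        a , λ i i≤a x x∈ → ιᵛ-injective (λ j → F.trans (sep i i≤a (ιᵛ x) x∈ j) (F.sym 0#-homo))

    lattice-preimage : ∀ k s y u → pow F Nᶠ k u VF.≋ ιᵛ y → Mᴴ[ + s ℤ.- + k ] y →
                       ∃ λ x → pow R N k x VR.≋ y
    lattice-preimage k zero y u _ y∈ =
      lattice-negative-part-in-image k y (reindex (ℤ.+-identityˡ _) y∈)
    lattice-preimage k (suc s) y u Nᵏu≋y y∈ =
      correct (proj₂ (proj₂ (proj₂ (graded-iso m))) w w∈)
      where
      m = suc s ℕ.+ k
      w = pow R N (suc s) y
      u∈ : M[ + m ] u
      u∈ = pow-reflects k (suc s) (M-resp _ (λ j → F.sym (Nᵏu≋y j)) y∈)
      Nᵐu≋w : pow F Nᶠ m u VF.≋ ιᵛ w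
      Nᵐu≋w j = begin
        pow F Nᶠ m u j                    ≡⟨ ≡.cong (λ z → z j) (VF.pow-+ Nᶠ (suc s) k u) ⟩
        pow F Nᶠ (suc s) (pow F Nᶠ k u) j ≈⟨ VF.pow-cong Nᶠ (suc s) Nᵏu≋y j ⟩
        pow F Nᶠ (suc s) (ιᵛ y) j         ≈⟨ ιᵛ-pow N (suc s) y j ⟨
        ι (w j)                           ∎
      w∈ : Mᴴ[ ℤ.- + m ] w
      w∈ = M-resp _ Nᵐu≋w (proj₁ (iso m) u u∈)
      shift : ∀ s k → (+ 1 ℤ.+ s) ℤ.+ k ℤ.- + 1 ℤ.- (k ℤ.+ k) ≡ s ℤ.- k
      shift = solve-∀
      correct : (∃ λ x′ → Mᴴ[ + m ] x′ × Mᴴ[ ℤ.- + m ℤ.- + 1 ] (_-ᵛ_ R (pow R N m x′) w)) →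
                ∃ λ x → pow R N k x VR.≋ y
      correct (x′ , x′∈ , r∈) = _-ᵛ_ R x′ x″ , λ j → R.trans (VR.pow--ᵛ N k x′ x″ j)
                                  (R.trans (R.+-congˡ (R.-‿cong (Nᵏx″≋d j))) (VR.x-[x-y]≈y _ _))
        where
        v = _-ᵛ_ F (ιᵛ x′) u
        d = _-ᵛ_ R (pow R N k x′) y
        v∈ : M[ + m ℤ.- + 1 ] v
        v∈ = proj₁ (proj₂ (proj₂ (iso m))) v (VF.-ᵛ-∈ (MF _) x′∈ u∈)
               (M-resp _ (λ j → F.sym (ιᵛ-pow--ᵛ m x′ Nᵐu≋w j)) r∈)
        d∈ : Mᴴ[ + s ℤ.- + k ] d
        d∈ = M-resp _ (ιᵛ-pow--ᵛ k x′ Nᵏu≋y) (reindex (shift (+ s) (+ k)) (M-pow k v∈))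
        preimage-of-d : ∃ λ x″ → pow R N k x″ VR.≋ d
        preimage-of-d = lattice-preimage k s d v (ιᵛ-pow--ᵛ k x′ Nᵏu≋y) d∈
        x″ = proj₁ preimage-of-d
        Nᵏx″≋d = proj₂ preimage-of-d

    graded-iso⇒torsion-free : IsField F → ∀ k → TorsionFreeCoker R (pow R N k)
    graded-iso⇒torsion-free isField k r y r≉0 (x , Nᵏx≋ry) =
      let (ρ , ιrρ≈1) = proj₂ isField (ι r) (ι≉0 r≉0)
          Nᵏ[ρx]≋y : pow F Nᶠ k (_·ᵛ_ F ρ (ιᵛ x)) VF.≋ ιᵛ y
          Nᵏ[ρx]≋y j = begin
            pow F Nᶠ k (_·ᵛ_ F ρ (ιᵛ x)) j ≈⟨ VF.pow-·ᵛ Nᶠ k ρ (ιᵛ x) j ⟩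
            ρ F.* pow F Nᶠ k (ιᵛ x) j      ≈⟨ F.*-congˡ (ιᵛ-pow N k x j) ⟨
            ρ F.* ι (pow R N k x j)        ≈⟨ F.*-congˡ (F.trans (⟦⟧-cong (Nᵏx≋ry j)) (*-homo r (y j))) ⟩
            ρ F.* (ι r F.* ι (y j))        ≈⟨ F.*-assoc _ _ _ ⟨
            ρ F.* ι r F.* ι (y j)          ≈⟨ F.*-congʳ (F.trans (F.*-comm _ _) ιrρ≈1) ⟩
            F.1# F.* ι (y j)               ≈⟨ F.*-identityˡ _ ⟩
            ι (y j)                        ∎
      in lattice-preimage k (ℤ.∣ b ∣ ℕ.+ k) y _ Nᵏ[ρx]≋y y∈
      where
      b = proj₁ exhaustive
      cancel : ∀ b k → b ℤ.+ k ℤ.- k ≡ b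
      cancel = solve-∀
      y∈ : Mᴴ[ + (ℤ.∣ b ∣ ℕ.+ k) ℤ.- + k ] y
      y∈ = reindex (≡.sym (cancel (+ ℤ.∣ b ∣) (+ k))) (proj₂ exhaustive _ (i≤+∣i∣ b) (ιᵛ y))

lemma2p10 : {c ℓ : Level} (R F : CommutativeRing c ℓ)
    (ι : CommutativeRing.Carrier R → CommutativeRing.Carrier F) →
    IsPID R → IsField F → IsFractionField R F ι →
    (n : ℕ) (N : Mat R n) → Nilpotent R N →
    (MF : ℤ → Subspace F n) → IsAssociatedFiltration F (mapMat R F ι N) MF →
    ((∀ (i : ℕ) → TorsionFreeCoker R (pow R N i))
      ⇔ (∀ (i : ℕ) → InducesIso R (pow R N i)
            (restrict R F ι (Subspace.mem (MF (+ i))))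
            (restrict R F ι (Subspace.mem (MF (+ i ℤ.- + 1))))
            (restrict R F ι (Subspace.mem (MF (ℤ.- + i))))
            (restrict R F ι (Subspace.mem (MF (ℤ.- + i ℤ.- + 1))))))
lemma2p10 R F ι (domain , _) isField frac n N _ MF filt =
  mk⇔ torsion-free⇒graded-iso (λ graded-iso → graded-iso⇒torsion-free graded-iso isField)
  where open Lattice R F domain frac N filt
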